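{- For $n\geq 1$, $$f_n(312,213,321)=\sum_{k=1}^n k!\,S(n,k).$$
   Context: A forest on $[n]$ is an unordered rooted forest whose $n$ vertices are labeled bijectively by $[n]$. A forest avoids a pattern $\sigma$ if for every vertex $v$, the sequence of labels along the path from the root of the tree containing $v$ down to $v$ contains no subsequence in the same relative order as $\sigma$. $f_n(\sigma_1,\ldots,\sigma_m)$ is the number of forests on $[n]$ avoiding every $\sigma_i$. $S(n,k)$ is the Stirling number of the second kind. -}

module Defs where

open import Data.Bool using (Bool; true; false; _∧_; _∨_; not; T)
open import Data.Nat using (ℕ; zero; suc; _+_; _*_; _!; _<ᵇ_)
open import Data.Fin using (Fin; toℕ)
open import Data.Maybe using (Maybe; just; nothing)
open import Data.List using (List; []; _∷_; map; length; reverse; upTo; allFin; concatMap; _++_; filterᵇ; zipWith)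
open import Data.Bool.ListAction using (and; or)
open import Data.Nat.ListAction using (sum)
open import Data.Vec using (Vec; lookup) renaming ([] to []ᵛ; _∷_ to _∷ᵛ_)

-- A (unordered, rooted, vertex-labelled) forest on the vertex set Fin n
-- (label of vertex i is toℕ i + 1) is encoded by its parent map:
-- entry v is  nothing  if v is a root, and  just u  if u is the parent of v.
-- A parent map describes a forest iff it has no cycle, i.e. following
-- parents from any vertex reaches a root within n steps.

Parent : ℕ → Set
Parent n = Vec (Maybe (Fin n)) n

ancestor : ∀ {n} → Parent n → ℕ → Fin n → Maybe (Fin n)
ancestor p zero    v = just v
ancestor p (suc k) v with lookup p v
... | nothing = nothing
... | just u  = ancestor p k u

isForest : ∀ {n} → Parent n → Bool
isForest {n} p = and (map (λ v → noAnc (ancestor p n v)) (allFin n))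
  where
  noAnc : Maybe (Fin n) → Bool
  noAnc nothing  = true
  noAnc (just _) = false

-- the vertices from v up to its root (fuel k; k = n suffices for forests)
upPath : ∀ {n} → Parent n → ℕ → Fin n → List (Fin n)
upPath p zero    v = v ∷ []
upPath p (suc k) v with lookup p v
... | nothing = v ∷ []
... | just u  = v ∷ upPath p k u

-- labels (shifted by -1, which does not affect relative order)
-- along the path from the root of v's tree down to v
rootPath : ∀ {n} → Parent n → Fin n → List ℕ
rootPath {n} p v = reverse (map toℕ (upPath p n v))

subseqs : List ℕ → List (List ℕ)
subseqs []       = [] ∷ []
subseqs (x ∷ xs) = map (x ∷_) (subseqs xs) ++ subseqs xs

sameOrder : List ℕ → List ℕ → Bool
sameOrder []       []       = true
sameOrder (a ∷ as) (b ∷ bs) =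
  and (zipWith (λ x y → iff (a <ᵇ x) (b <ᵇ y) ∧ iff (x <ᵇ a) (y <ᵇ b)) as bs)
  ∧ sameOrder as bs
  where
  iff : Bool → Bool → Bool
  iff true  c = c
  iff false c = not c
sameOrder _        _        = false

contains : List ℕ → List ℕ → Bool
contains σ w = or (map (sameOrder σ) (subseqs w))

avoids : ∀ {n} → Parent n → List ℕ → Bool
avoids {n} p σ = and (map (λ v → not (contains σ (rootPath p v))) (allFin n))

avoidsAll : ∀ {n} → Parent n → List (List ℕ) → Bool
avoidsAll p σs = and (map (avoids p) σs)

allVecs : ∀ {A : Set} → List A → (n : ℕ) → List (Vec A n)
allVecs xs zero    = []ᵛ ∷ []
allVecs xs (suc n) = concatMap (λ x → map (x ∷ᵛ_) (allVecs xs n)) xs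

allParents : (n : ℕ) → List (Parent n)
allParents n = allVecs (nothing ∷ map just (allFin n)) n

f : ℕ → List (List ℕ) → ℕ
f n σs = length (filterᵇ (λ p → isForest p ∧ avoidsAll p σs) (allParents n))

S : ℕ → ℕ → ℕ
S zero    zero    = 1
S zero    (suc k) = 0
S (suc n) zero    = 0
S (suc n) (suc k) = suc k * S n (suc k) + S n k

fubini : ℕ → ℕ
fubini n = sum (map (λ k → suc k ! * S n (suc k)) (upTo n))

-- The patterns 312, 213 and 321 are exactly the patterns of length three that start with a
-- descent, so a forest avoids them iff every root-to-vertex path increases except possibly at
-- its last step, i.e. iff every vertex with a child is a root or has a smaller parent.  For a
-- parent map without self-loops this local condition already forces acyclicity.  Recording for
-- every vertex whether its parent is larger (an ascent) turns the condition into independent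
-- choices: an ascent hangs below a larger non-ascent, and a non-ascent is a root or hangs below
-- a smaller non-ascent.  Summing the resulting products over the ascent vectors with m
-- non-ascents gives m! S(n,m), by the Stirling recurrence applied at the smallest vertex.
module Submission where

open import Defs
import Algebra.Properties.CommutativeSemigroup as CommutativeSemigroupProperties
open import Data.Bool using (Bool; true; false; not; _∧_; if_then_else_; T)
open import Data.Bool.Properties using (T-∧; T-≡; T-not-≡) renaming (_≟_ to _≟ᵇ_)
open import Data.Bool.ListAction using (all)
open import Data.Empty using (⊥; ⊥-elim)
open import Data.Fin using (Fin; toℕ) renaming (zero to fzero; suc to fsuc)
open import Data.Fin.Properties using (toℕ-injective; toℕ<n) renaming (_≟_ to _≟ᶠ_)
open import Data.List using (List; []; _∷_; _++_; map; reverse; length; filterᵇ; concatMap; allFin; upTo)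
open import Data.List.Properties using (unfold-reverse; reverse-++; map-++; map-∘; map-cong; map-tabulate; map-applyUpTo)
open import Data.List.Membership.Propositional using (_∈_; find; lose)
open import Data.List.Membership.Propositional.Properties using (∈-allFin; ∈-map⁺; ∈-map⁻; ∈-++⁺ˡ; ∈-++⁺ʳ; ∈-++⁻)
open import Data.List.Relation.Unary.All as All using (All; []; _∷_)
open import Data.List.Relation.Unary.All.Properties using (all⁺; all⁻; ∷ʳ⁺) renaming (tabulate⁺ to All-tabulate⁺)
open import Data.List.Relation.Unary.All.Properties.Core using (¬All⇒Any¬)
open import Data.List.Relation.Unary.AllPairs using (AllPairs; []; _∷_)
import Data.List.Relation.Unary.AllPairs.Properties as AllPairs
open import Data.List.Relation.Unary.Any using (here; there)
open import Data.List.Relation.Unary.Any.Properties using (any⁺; any⁻)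
open import Data.List.Relation.Binary.Sublist.Propositional using (_⊆_; []; _∷_; _∷ʳ_; ⊆-refl)
open import Data.List.Relation.Binary.Sublist.Propositional.Properties using (++⁺ˡ)
open import Data.Maybe using (Maybe; just; nothing)
open import Data.Nat using (ℕ; zero; suc; pred; _+_; _*_; _≤_; _<_; _<ᵇ_; _≡ᵇ_; _!; s≤s; z≤n; s≤s⁻¹; s<s; z<s)
open import Data.Nat.Properties
open import Data.Nat.ListAction using (sum; product)
open import Data.Nat.ListAction.Properties using (sum-++)
open import Data.Nat.Tactic.RingSolver using (solve-∀)
open import Data.Product using (∃-syntax; _×_; _,_; proj₁; proj₂)
open import Data.Sum using (inj₁; inj₂)
open import Data.Vec using (Vec; lookup; tabulate) renaming ([] to []ᵛ; _∷_ to _∷ᵛ_)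
open import Data.Vec.Properties using (≡-dec; lookup∘tabulate; tabulate∘lookup; tabulate-cong)
open import Function using (_⇔_; mk⇔; _∘_; _∘′_; module Equivalence)
open import Relation.Nullary using (¬_; Dec; yes; no)
open import Relation.Nullary.Decidable using (T?; does)
open import Relation.Nullary.Reflects using (ofʸ; ofⁿ)
open import Relation.Binary.Definitions using (tri<; tri≈; tri>)
open import Relation.Binary.PropositionalEquality using (_≡_; _≢_; refl; sym; trans; cong; cong₂; subst; module ≡-Reasoning)

open CommutativeSemigroupProperties +-commutativeSemigroup using (interchange; x∙yz≈yx∙z)
open CommutativeSemigroupProperties *-commutativeSemigroup using (xy∙z≈y∙xz; x∙yz≈y∙xz)

T-all-allFin : ∀ {n} (g : Fin n → Bool) → T (all g (allFin n)) ⇔ (∀ v → T (g v))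
T-all-allFin g = mk⇔ (λ t v → All.lookup (all⁺ g _ t) (∈-allFin v)) (λ h → all⁻ g (All-tabulate⁺ h))

all-allFin-counterexample : ∀ {n} (g : Fin n → Bool) → ¬ T (all g (allFin n)) → ∃[ v ] ¬ T (g v)
all-allFin-counterexample {n} g ¬all with find (¬All⇒Any¬ (T? ∘ g) (allFin n) (¬all ∘ all⁻ g))
... | v , _ , ¬gv = v , ¬gv

T-not : ∀ {b} → T (not b) ⇔ (¬ T b)
T-not {true}  = mk⇔ (λ ()) (λ f → f _)
T-not {false} = mk⇔ (λ _ ()) (λ _ → _)

T-injective : ∀ {a b} → (T a ⇔ T b) → a ≡ b
T-injective {true}  {true}  _   = refl
T-injective {true}  {false} a⇔b = ⊥-elim (Equivalence.to a⇔b _)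
T-injective {false} {true}  a⇔b = ⊥-elim (Equivalence.from a⇔b _)
T-injective {false} {false} _   = refl

T-∧⁻ : ∀ x {y} → T (x ∧ y) → T x × T y
T-∧⁻ true  t = _ , t

<ᵇ-true : ∀ {m n} → m < n → (m <ᵇ n) ≡ true
<ᵇ-true m<n = Equivalence.to T-≡ (<⇒<ᵇ m<n)

<ᵇ-false : ∀ {m n} → n ≤ m → (m <ᵇ n) ≡ false
<ᵇ-false {m} {n} n≤m = Equivalence.to T-not-≡ (Equivalence.from T-not (λ m<n → <⇒≱ (<ᵇ⇒< m n m<n) n≤m))

∈-subseqs⁺ : ∀ {s w} → s ⊆ w → s ∈ subseqs w
∈-subseqs⁺ []               = here refl
∈-subseqs⁺ (y ∷ʳ s⊆w)       = ∈-++⁺ʳ _ (∈-subseqs⁺ s⊆w)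
∈-subseqs⁺ (refl ∷ s⊆w)     = ∈-++⁺ˡ (∈-map⁺ (_ ∷_) (∈-subseqs⁺ s⊆w))

∈-subseqs⁻ : ∀ {s} w → s ∈ subseqs w → s ⊆ w
∈-subseqs⁻ []      (here refl) = []
∈-subseqs⁻ (x ∷ w) s∈ with ∈-++⁻ (map (x ∷_) (subseqs w)) s∈
... | inj₁ s∈map with ∈-map⁻ (x ∷_) s∈map
...   | t , t∈ , refl = refl ∷ ∈-subseqs⁻ w t∈
∈-subseqs⁻ (x ∷ w) s∈ | inj₂ s∈rest = x ∷ʳ ∈-subseqs⁻ w s∈rest

contains⇔ : ∀ σ w → T (contains σ w) ⇔ (∃[ s ] s ⊆ w × T (sameOrder σ s))
contains⇔ σ w = mk⇔ to from
  where
  to : T (contains σ w) → ∃[ s ] s ⊆ w × T (sameOrder σ s)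
  to t with find (any⁻ (sameOrder σ) (subseqs w) t)
  ... | s , s∈ , ord = s , ∈-subseqs⁻ w s∈ , ord
  from : ∃[ s ] s ⊆ w × T (sameOrder σ s) → T (contains σ w)
  from (s , s⊆w , ord) = any⁺ (sameOrder σ) (lose (∈-subseqs⁺ s⊆w) ord)

sameOrder-descent : ∀ {a b c σ s} → b < a → T (sameOrder (a ∷ b ∷ c ∷ σ) s) →
                    ∃[ x ] ∃[ y ] ∃[ z ] ∃[ r ] s ≡ x ∷ y ∷ z ∷ r × y < x
sameOrder-descent {s = []} _ ()
sameOrder-descent {s = x ∷ []} _ ()
sameOrder-descent {b = b} {c} {σ} {x ∷ y ∷ []} _ ord = ⊥-elim (proj₂ (T-∧⁻ _ {sameOrder (b ∷ c ∷ σ) (y ∷ [])} ord))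
-- sameOrder only computes once the comparisons between the first two entries are known.
sameOrder-descent {a} {b} {s = x ∷ y ∷ z ∷ r} b<a ord
  with b <ᵇ a | <ᵇ-true b<a | a <ᵇ b | <ᵇ-false (<⇒≤ b<a) | y <ᵇ x | <ᵇ-reflects-< y x | x <ᵇ y
... | _ | refl | _ | refl | true  | ofʸ y<x | _     = x , y , z , r , refl , y<x
... | _ | refl | _ | refl | false | _       | true  = ⊥-elim ord
... | _ | refl | _ | refl | false | _       | false = ⊥-elim ord

head∈init : ∀ {y w z : ℕ} {r is} → (y ∷ w ∷ r) ⊆ is ++ z ∷ [] → y ∈ is
head∈init {is = []}     (_ ∷ʳ ())
head∈init {is = []}     (refl ∷ ())
head∈init {is = _ ∷ is} (_ ∷ʳ τ)   = there (head∈init {is = is} τ)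
head∈init {is = _ ∷ _}  (refl ∷ τ) = here refl

⊆-increasing-init⇒< : ∀ {inc z x y w r} → AllPairs _<_ inc → (x ∷ y ∷ w ∷ r) ⊆ inc ++ z ∷ [] → x < y
⊆-increasing-init⇒< []          (_ ∷ʳ ())
⊆-increasing-init⇒< []          (refl ∷ ())
⊆-increasing-init⇒< {_ ∷ inc} (_ ∷ inc<) (_ ∷ʳ τ) = ⊆-increasing-init⇒< {inc} inc< τ
⊆-increasing-init⇒< {_ ∷ inc} (x< ∷ _) (refl ∷ τ) = All.lookup x< (head∈init {is = inc} τ)

¬contains-descent-start : ∀ {inc z a b c σ} → AllPairs _<_ inc → b < a →
                          ¬ T (contains (a ∷ b ∷ c ∷ σ) (inc ++ z ∷ []))
¬contains-descent-start {inc} {z} {a} {b} {c} {σ} inc< b<a t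
  with Equivalence.to (contains⇔ (a ∷ b ∷ c ∷ σ) (inc ++ z ∷ [])) t
... | s , s⊆ , ord with sameOrder-descent {s = s} b<a ord
...   | x , y , _ , _ , refl , y<x = <-asym (⊆-increasing-init⇒< {inc} inc< s⊆) y<x

-- Admissible parent maps are pattern-avoiding forests

T-isForest : ∀ {n} (p : Parent n) → T (isForest p) ⇔ (∀ v → ancestor p n v ≡ nothing)
T-isForest {n} p = mk⇔ to from
  where
  to : T (isForest p) → ∀ v → ancestor p n v ≡ nothing
  to forest v with ancestor p n v | Equivalence.to (T-all-allFin _) forest v
  ... | nothing | _ = refl
  -- isForest tests each vertex with a local function that cannot be named here, hence the
  -- detour through a counterexample.
  from : (∀ v → ancestor p n v ≡ nothing) → T (isForest p)
  from h with T? (isForest p)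
  ... | yes forest = forest
  ... | no ¬forest with all-allFin-counterexample _ ¬forest
  ...   | v , ¬noAnc with ancestor p n v | h v
  ...     | nothing | refl = ⊥-elim (¬noAnc _)

closeGap : ℕ → ℕ → ℕ
closeGap c a = if c <ᵇ a then pred a else a

closeGap-mono : ∀ {c a b} → a < b → a ≢ c → b ≢ c → closeGap c a < closeGap c b
closeGap-mono {c} {a} {b} a<b a≢c b≢c with c <ᵇ a | <ᵇ-reflects-< c a | c <ᵇ b | <ᵇ-reflects-< c b
... | true  | ofʸ (s≤s _) | true  | _       = pred-mono-< a<b
... | true  | ofʸ c<a     | false | ofⁿ c≮b = ⊥-elim (c≮b (<-trans c<a a<b))
... | false | ofⁿ c≮a     | true  | ofʸ c<b = <-≤-trans (≤∧≢⇒< (≮⇒≥ c≮a) a≢c) (<⇒≤pred c<b)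
... | false | _           | false | _       = a<b

closeGap-< : ∀ {c a m} → a ≢ c → a ≤ m → c ≤ m → closeGap c a < m
closeGap-< {c} {a} a≢c a≤m c≤m with c <ᵇ a | <ᵇ-reflects-< c a
... | true  | ofʸ (s≤s _) = a≤m
... | false | ofⁿ c≮a     = <-≤-trans (≤∧≢⇒< (≮⇒≥ c≮a) a≢c) c≤m

module _ {n : ℕ} (p : Parent n) where

  HasChild : Fin n → Set
  HasChild u = ∃[ c ] lookup p c ≡ just u

  record Admissible : Set where
    field
      no-self-loop     : ∀ {v u} → lookup p v ≡ just u → u ≢ v
      internal-descends : ∀ {u x} → HasChild u → lookup p u ≡ just x → toℕ x < toℕ u

  ancestor-descent : (μ : Fin n → ℕ) (I : Fin n → Set) →
                     (∀ {y x} → I y → lookup p y ≡ just x → I x × μ x < μ y) →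
                     ∀ k {y z} → I y → ancestor p k y ≡ just z → μ z + k ≤ μ y
  ancestor-descent μ I step zero {y} _ refl = ≤-reflexive (+-identityʳ (μ y))
  ancestor-descent μ I step (suc k) {y} {z} Iy anc with lookup p y in py
  ancestor-descent μ I step (suc k) {y} {z} Iy () | nothing
  ... | just x with step Iy py
  ...   | Ix , μx<μy = begin
    μ z + suc k    ≡⟨ +-suc (μ z) k ⟩
    suc (μ z + k)  ≤⟨ s≤s (ancestor-descent μ I step k Ix anc) ⟩
    suc (μ x)      ≤⟨ μx<μy ⟩
    μ y            ∎
    where open ≤-Reasoning

admissible⇒forest : ∀ {n} (p : Parent n) → Admissible p → T (isForest p)
admissible⇒forest {zero}  p adm = _
admissible⇒forest {suc m} p adm = Equivalence.from (T-isForest p) no-long-chain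
  where
  open Admissible adm
  -- Above the parent of v the labels strictly decrease and never meet v again (v is childless
  -- unless its parent is smaller), so once the gap at v is closed a chain of m steps has to
  -- start at a value ≥ m, while the parent of v sits below m.
  no-long-chain : ∀ v → ancestor p (suc m) v ≡ nothing
  no-long-chain v with lookup p v in pv
  ... | nothing = refl
  ... | just x₁ with ancestor p m x₁ in anc
  ...   | nothing = refl
  ...   | just z  = ⊥-elim (<-irrefl refl (begin-strict
            m            ≤⟨ m≤n+m m (μ z) ⟩
            μ z + m      ≤⟨ ancestor-descent p μ I step m I-x₁ anc ⟩
            μ x₁         <⟨ closeGap-< (I⇒≢v I-x₁) (s≤s⁻¹ (toℕ<n x₁)) (s≤s⁻¹ (toℕ<n v)) ⟩
            m            ∎))
    where
    open ≤-Reasoning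
    I : Fin (suc m) → Set
    I w = HasChild p w × (HasChild p v → toℕ w < toℕ v)
    μ : Fin (suc m) → ℕ
    μ w = closeGap (toℕ v) (toℕ w)
    I⇒≢v : ∀ {w} → I w → toℕ w ≢ toℕ v
    I⇒≢v (child , below) w≡v = <-irrefl w≡v (below (subst (HasChild p) (toℕ-injective w≡v) child))
    step : ∀ {y x} → I y → lookup p y ≡ just x → I x × μ x < μ y
    step {y} {x} Iy@(child , below) py = Ix , closeGap-mono x<y (I⇒≢v Ix) (I⇒≢v Iy)
      where
      x<y : toℕ x < toℕ y
      x<y = internal-descends child py
      Ix : I x
      Ix = (y , py) , λ hv → <-trans x<y (below hv)
    I-x₁ : I x₁
    I-x₁ = (v , pv) , λ hv → internal-descends hv pv

module _ {n} {p : Parent n} (adm : Admissible p) where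
  open Admissible adm

  reverse-upPath-increasing : ∀ k {y} → HasChild p y →
    AllPairs _<_ (reverse (map toℕ (upPath p k y))) × All (_≤ toℕ y) (reverse (map toℕ (upPath p k y)))
  reverse-upPath-increasing zero _ = [] ∷ [] , ≤-refl ∷ []
  reverse-upPath-increasing (suc k) {y} child with lookup p y in py
  ... | nothing = [] ∷ [] , ≤-refl ∷ []
  ... | just x with reverse-upPath-increasing k (y , py)
  ...   | inc< , ≤x = subst (λ L → AllPairs _<_ L × All (_≤ toℕ y) L)
                            (sym (unfold-reverse (toℕ y) (map toℕ (upPath p k x))))
                            ( AllPairs.++⁺ inc< ([] ∷ []) (All.map (λ a≤x → ≤-<-trans a≤x x<y ∷ []) ≤x)
                            , ∷ʳ⁺ (All.map (λ a≤x → ≤-trans a≤x (<⇒≤ x<y)) ≤x) ≤-refl)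
    where
    x<y : toℕ x < toℕ y
    x<y = internal-descends child py

  rootPath-increasing-but-last : ∀ v → ∃[ inc ] AllPairs _<_ inc × rootPath p v ≡ inc ++ toℕ v ∷ []
  rootPath-increasing-but-last v = with-fuel n v
    where
    with-fuel : ∀ k v → ∃[ inc ] AllPairs _<_ inc × reverse (map toℕ (upPath p k v)) ≡ inc ++ toℕ v ∷ []
    with-fuel zero v = [] , [] , refl
    with-fuel (suc k) v with lookup p v in pv
    ... | nothing = [] , [] , refl
    ... | just x  = reverse (map toℕ (upPath p k x)) , proj₁ (reverse-upPath-increasing k (v , pv))
                  , unfold-reverse (toℕ v) (map toℕ (upPath p k x))

  admissible⇒avoids : ∀ {a b c σ} → b < a → T (avoids p (a ∷ b ∷ c ∷ σ))
  admissible⇒avoids {a} {b} {c} {σ} b<a = Equivalence.from (T-all-allFin _) λ v →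
    let inc , inc< , path≡ = rootPath-increasing-but-last v
    in Equivalence.from T-not (subst (λ w → ¬ T (contains (a ∷ b ∷ c ∷ σ) w)) (sym path≡) (¬contains-descent-start inc< b<a))

-- Pattern-avoiding forests are admissible

headDescentPatterns : List (List ℕ)
headDescentPatterns = (3 ∷ 1 ∷ 2 ∷ []) ∷ (2 ∷ 1 ∷ 3 ∷ []) ∷ (3 ∷ 2 ∷ 1 ∷ []) ∷ []

order-321 : ∀ {x y z} → z < y → y < x → T (sameOrder (3 ∷ 2 ∷ 1 ∷ []) (x ∷ y ∷ z ∷ []))
order-321 z<y y<x rewrite <ᵇ-true z<y | <ᵇ-false (<⇒≤ z<y) | <ᵇ-true y<x | <ᵇ-false (<⇒≤ y<x)
                        | <ᵇ-true (<-trans z<y y<x) | <ᵇ-false (<⇒≤ (<-trans z<y y<x)) = _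

order-312 : ∀ {x y z} → y < z → z < x → T (sameOrder (3 ∷ 1 ∷ 2 ∷ []) (x ∷ y ∷ z ∷ []))
order-312 y<z z<x rewrite <ᵇ-true y<z | <ᵇ-false (<⇒≤ y<z) | <ᵇ-true z<x | <ᵇ-false (<⇒≤ z<x)
                        | <ᵇ-true (<-trans y<z z<x) | <ᵇ-false (<⇒≤ (<-trans y<z z<x)) = _

order-213 : ∀ {x y z} → y < x → x < z → T (sameOrder (2 ∷ 1 ∷ 3 ∷ []) (x ∷ y ∷ z ∷ []))
order-213 y<x x<z rewrite <ᵇ-true y<x | <ᵇ-false (<⇒≤ y<x) | <ᵇ-true x<z | <ᵇ-false (<⇒≤ x<z)
                        | <ᵇ-true (<-trans y<x x<z) | <ᵇ-false (<⇒≤ (<-trans y<x x<z)) = _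

module _ {n : ℕ} (p : Parent n) where

  ancestors-on-2-cycle : ∀ {v u} → lookup p v ≡ just u → lookup p u ≡ just v →
                         ∀ k → (∃[ z ] ancestor p k v ≡ just z) × (∃[ z ] ancestor p k u ≡ just z)
  ancestors-on-2-cycle {v} {u} pv pu zero = (v , refl) , (u , refl)
  ancestors-on-2-cycle pv pu (suc k) rewrite pv | pu =
    let from-v , from-u = ancestors-on-2-cycle pv pu k in from-u , from-v

  forest-no-2-cycle : T (isForest p) → ∀ {v u} → lookup p v ≡ just u → lookup p u ≡ just v → ⊥
  forest-no-2-cycle forest {v} pv pu with ancestors-on-2-cycle pv pu n
  ... | (z , anc) , _ with trans (sym anc) (Equivalence.to (T-isForest p) forest v)
  ...   | ()

  upPath-head : ∀ k v → ∃[ rest ] upPath p k v ≡ v ∷ rest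
  upPath-head zero    v = [] , refl
  upPath-head (suc k) v with lookup p v
  ... | nothing = [] , refl
  ... | just _  = _ , refl

module _ {m : ℕ} (p : Parent (suc (suc m))) where

  rootPath-ends : ∀ {v u x} → lookup p v ≡ just u → lookup p u ≡ just x →
                  ∃[ pre ] rootPath p v ≡ pre ++ toℕ x ∷ toℕ u ∷ toℕ v ∷ []
  rootPath-ends {v} {u} {x} pv pu with upPath-head p m x
  ... | rest , up≡ = reverse (map toℕ rest) , (begin
    rootPath p v                                            ≡⟨ cong (reverse ∘′ map toℕ) path≡ ⟩
    reverse ((toℕ v ∷ toℕ u ∷ toℕ x ∷ []) ++ map toℕ rest)  ≡⟨ reverse-++ (toℕ v ∷ toℕ u ∷ toℕ x ∷ []) (map toℕ rest) ⟩
    reverse (map toℕ rest) ++ toℕ x ∷ toℕ u ∷ toℕ v ∷ []    ∎)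
    where
    open ≡-Reasoning
    path≡ : upPath p (suc (suc m)) v ≡ v ∷ u ∷ x ∷ rest
    path≡ rewrite pv | pu | up≡ = refl

avoids⇒¬suffix-matches : ∀ {n} (p : Parent n) {σ v pre s} → T (avoids p σ) →
                         rootPath p v ≡ pre ++ s → ¬ T (sameOrder σ s)
avoids⇒¬suffix-matches p {σ} {v} {pre} avoids-σ path≡ ord =
  Equivalence.to T-not (Equivalence.to (T-all-allFin _) avoids-σ v)
    (Equivalence.from (contains⇔ σ (rootPath p v)) (_ , subst (_ ⊆_) (sym path≡) (++⁺ˡ pre ⊆-refl) , ord))

avoidsAll⇒parents-not-ascents : ∀ {n} (p : Parent n) → T (avoidsAll p headDescentPatterns) →
  ∀ {v u x} → lookup p v ≡ just u → lookup p u ≡ just x → toℕ u < toℕ x → toℕ x ≢ toℕ v → toℕ u ≢ toℕ v → ⊥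
avoidsAll⇒parents-not-ascents {suc zero} p _ {u = fzero} {fzero} _ _ ()
avoidsAll⇒parents-not-ascents {suc (suc m)} p avoiding {v} {u} {x} pv pu u<x x≢v u≢v
  with all⁺ (avoids p) headDescentPatterns avoiding | rootPath-ends p pv pu
... | avoids-312 ∷ avoids-213 ∷ avoids-321 ∷ [] | _ , path≡ with <-cmp (toℕ v) (toℕ u)
...   | tri< v<u _ _ = avoids⇒¬suffix-matches p avoids-321 path≡ (order-321 v<u u<x)
...   | tri≈ _ v≡u _ = u≢v (sym v≡u)
...   | tri> _ _ u<v with <-cmp (toℕ v) (toℕ x)
...     | tri< v<x _ _ = avoids⇒¬suffix-matches p avoids-312 path≡ (order-312 u<v v<x)
...     | tri≈ _ v≡x _ = x≢v (sym v≡x)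
...     | tri> _ _ x<v = avoids⇒¬suffix-matches p avoids-213 path≡ (order-213 u<x x<v)

forest-avoiding⇒admissible : ∀ {n} (p : Parent n) → T (isForest p) → T (avoidsAll p headDescentPatterns) →
                             Admissible p
forest-avoiding⇒admissible p forest avoiding = record { no-self-loop = no-loop ; internal-descends = descends }
  where
  no-loop : ∀ {v u} → lookup p v ≡ just u → u ≢ v
  no-loop pv refl = forest-no-2-cycle p forest pv pv

  descends : ∀ {u x} → HasChild p u → lookup p u ≡ just x → toℕ x < toℕ u
  descends {u} {x} (c , pc) pu with <-cmp (toℕ x) (toℕ u)
  ... | tri< x<u _ _ = x<u
  ... | tri≈ _ x≡u _ = ⊥-elim (no-loop pu (toℕ-injective x≡u))
  ... | tri> _ _ u<x with x ≟ᶠ c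
  ...   | yes refl = ⊥-elim (forest-no-2-cycle p forest pc pu)
  ...   | no x≢c   = ⊥-elim (avoidsAll⇒parents-not-ascents p avoiding pc pu u<x
                                (x≢c ∘ toℕ-injective) (no-loop pc ∘ toℕ-injective))

forest-avoiding⇔admissible : ∀ {n} (p : Parent n) →
                             T (isForest p ∧ avoidsAll p headDescentPatterns) ⇔ Admissible p
forest-avoiding⇔admissible p = mk⇔
  (λ t → let forest , avoiding = Equivalence.to T-∧ t in forest-avoiding⇒admissible p forest avoiding)
  (λ adm → Equivalence.from T-∧
    ( admissible⇒forest p adm
    , all⁻ (avoids p) {xs = headDescentPatterns} ( admissible⇒avoids adm (s<s z<s)
                      ∷ admissible⇒avoids adm (s<s z<s)
                      ∷ admissible⇒avoids adm (s<s (s<s z<s)) ∷ [])))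

open ≡-Reasoning

-- An ascent vector D marks the vertices whose parent has a larger label.  For fixed D,
-- compatibility is a conjunction of independent conditions on the parents of the single
-- vertices.
module _ {n : ℕ} where

  ascentAt : Fin n → Maybe (Fin n) → Bool
  ascentAt v nothing  = false
  ascentAt v (just u) = toℕ v <ᵇ toℕ u

  ascents : Parent n → Vec Bool n
  ascents p = tabulate (λ v → ascentAt v (lookup p v))

  edgeAllowed : Vec Bool n → Fin n → Fin n → Bool
  edgeAllowed D v u = (if lookup D v then toℕ v <ᵇ toℕ u else toℕ u <ᵇ toℕ v) ∧ not (lookup D u)

  parentAllowed : Vec Bool n → Fin n → Maybe (Fin n) → Bool
  parentAllowed D v nothing  = not (lookup D v)
  parentAllowed D v (just u) = edgeAllowed D v u

  compatible : Vec Bool n → Parent n → Bool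
  compatible D p = all (λ v → parentAllowed D v (lookup p v)) (allFin n)

  compatible⇒ascents : ∀ {D p} → T (compatible D p) → ∀ v → lookup D v ≡ ascentAt v (lookup p v)
  compatible⇒ascents {D} {p} compat v with lookup p v | Equivalence.to (T-all-allFin _) compat v
  ... | nothing | allowed = Equivalence.to T-not-≡ allowed
  ... | just u  | allowed with lookup D v
  ...   | true  = sym (Equivalence.to T-≡ (proj₁ (T-∧⁻ (toℕ v <ᵇ toℕ u) allowed)))
  ...   | false = sym (<ᵇ-false (<⇒≤ (<ᵇ⇒< (toℕ u) (toℕ v) (proj₁ (T-∧⁻ (toℕ u <ᵇ toℕ v) allowed)))))

module _ {n : ℕ} {p : Parent n} where

  lookup-ascents : ∀ v → lookup (ascents p) v ≡ ascentAt v (lookup p v)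
  lookup-ascents = lookup∘tabulate (λ v → ascentAt v (lookup p v))

  admissible⇒compatible : Admissible p → T (compatible (ascents p) p)
  admissible⇒compatible adm = Equivalence.from (T-all-allFin _) allowed
    where
    open Admissible adm
    allowed : ∀ v → T (parentAllowed (ascents p) v (lookup p v))
    allowed v with lookup p v in pv
    ... | nothing rewrite lookup-ascents v | pv = _
    ... | just u rewrite lookup-ascents v | lookup-ascents u | pv = Equivalence.from T-∧ (oriented , parent-is-no-ascent)
      where
      oriented : T (if toℕ v <ᵇ toℕ u then toℕ v <ᵇ toℕ u else toℕ u <ᵇ toℕ v)
      oriented with toℕ v <ᵇ toℕ u | <ᵇ-reflects-< (toℕ v) (toℕ u)
      ... | true  | ofʸ _   = _
      ... | false | ofⁿ v≮u = <⇒<ᵇ (≤∧≢⇒< (≮⇒≥ v≮u) (no-self-loop pv ∘ toℕ-injective))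
      parent-is-no-ascent : T (not (ascentAt u (lookup p u)))
      parent-is-no-ascent with lookup p u in pu
      ... | nothing = _
      ... | just x  = Equivalence.from T-not-≡ (<ᵇ-false (<⇒≤ (internal-descends (v , pv) pu)))

  compatible⇒admissible : ∀ {D} → T (compatible D p) → Admissible p
  compatible⇒admissible {D} compat = record { no-self-loop = no-loop ; internal-descends = descends }
    where
    allowed : ∀ {v u} → lookup p v ≡ just u → T (edgeAllowed D v u)
    allowed {v} pv = subst (T ∘ parentAllowed D v) pv (Equivalence.to (T-all-allFin _) compat v)
    no-loop : ∀ {v u} → lookup p v ≡ just u → u ≢ v
    no-loop {v} pv refl with lookup D v | allowed pv
    ... | true  | v<v = <-irrefl refl (<ᵇ⇒< (toℕ v) (toℕ v) (proj₁ (T-∧⁻ (toℕ v <ᵇ toℕ v) v<v)))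
    ... | false | v<v = <-irrefl refl (<ᵇ⇒< (toℕ v) (toℕ v) (proj₁ (T-∧⁻ (toℕ v <ᵇ toℕ v) v<v)))
    descends : ∀ {u x} → HasChild p u → lookup p u ≡ just x → toℕ x < toℕ u
    descends {u} {x} (c , pc) pu = ≤∧≢⇒< (≮⇒≥ u≮x) (no-loop pu ∘ toℕ-injective)
      where
      u-no-ascent : (toℕ u <ᵇ toℕ x) ≡ false
      u-no-ascent = begin
        toℕ u <ᵇ toℕ x           ≡⟨ cong (ascentAt u) pu ⟨
        ascentAt u (lookup p u)  ≡⟨ compatible⇒ascents {D = D} {p = p} compat u ⟨
        lookup D u               ≡⟨ Equivalence.to T-not-≡ (proj₂ (T-∧⁻ _ (allowed pc))) ⟩
        false                    ∎
      u≮x : ¬ toℕ u < toℕ x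
      u≮x u<x = subst T u-no-ascent (<⇒<ᵇ u<x)

forest-avoiding≡compatible : ∀ {n} (p : Parent n) →
  isForest p ∧ avoidsAll p headDescentPatterns ≡ compatible (ascents p) p
forest-avoiding≡compatible p = T-injective (mk⇔
  (admissible⇒compatible ∘ Equivalence.to (forest-avoiding⇔admissible p))
  (Equivalence.from (forest-avoiding⇔admissible p) ∘ compatible⇒admissible))

private
  variable
    A B : Set

𝟙 : Bool → ℕ
𝟙 true  = 1
𝟙 false = 0

𝟙-∧ : ∀ a b → 𝟙 (a ∧ b) ≡ 𝟙 a * 𝟙 b
𝟙-∧ true  b = sym (+-identityʳ (𝟙 b))
𝟙-∧ false b = refl

𝟙-all : ∀ (g : A → Bool) xs → 𝟙 (all g xs) ≡ product (map (𝟙 ∘ g) xs)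
𝟙-all g []       = refl
𝟙-all g (x ∷ xs) = trans (𝟙-∧ (g x) (all g xs)) (cong (𝟙 (g x) *_) (𝟙-all g xs))

length-filterᵇ : ∀ (P : A → Bool) xs → length (filterᵇ P xs) ≡ sum (map (𝟙 ∘ P) xs)
length-filterᵇ P []       = refl
length-filterᵇ P (x ∷ xs) with P x
... | true  = cong suc (length-filterᵇ P xs)
... | false = length-filterᵇ P xs

sum-map-cong : ∀ {f g : A → ℕ} xs → (∀ x → f x ≡ g x) → sum (map f xs) ≡ sum (map g xs)
sum-map-cong xs f≗g = cong sum (map-cong f≗g xs)

sum-map-zero : ∀ (xs : List A) → sum (map (λ _ → 0) xs) ≡ 0
sum-map-zero []       = refl
sum-map-zero (_ ∷ xs) = sum-map-zero xs

sum-map-+ : ∀ (f g : A → ℕ) xs → sum (map (λ x → f x + g x) xs) ≡ sum (map f xs) + sum (map g xs)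
sum-map-+ f g []       = refl
sum-map-+ f g (x ∷ xs) = trans (cong (f x + g x +_) (sum-map-+ f g xs))
                               (interchange (f x) (g x) (sum (map f xs)) (sum (map g xs)))

sum-map-*ˡ : ∀ c (f : A → ℕ) xs → sum (map (λ x → c * f x) xs) ≡ c * sum (map f xs)
sum-map-*ˡ c f []       = sym (*-zeroʳ c)
sum-map-*ˡ c f (x ∷ xs) = trans (cong (c * f x +_) (sum-map-*ˡ c f xs)) (sym (*-distribˡ-+ c (f x) _))

sum-map-*ʳ : ∀ c (f : A → ℕ) xs → sum (map (λ x → f x * c) xs) ≡ sum (map f xs) * c
sum-map-*ʳ c f []       = refl
sum-map-*ʳ c f (x ∷ xs) = trans (cong (f x * c +_) (sum-map-*ʳ c f xs)) (sym (*-distribʳ-+ c (f x) _))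

sum-map-concatMap : ∀ (f : B → ℕ) (g : A → List B) xs →
                    sum (map f (concatMap g xs)) ≡ sum (map (λ x → sum (map f (g x))) xs)
sum-map-concatMap f g []       = refl
sum-map-concatMap f g (x ∷ xs) = begin
  sum (map f (g x ++ concatMap g xs))            ≡⟨ cong sum (map-++ f (g x) (concatMap g xs)) ⟩
  sum (map f (g x) ++ map f (concatMap g xs))    ≡⟨ sum-++ (map f (g x)) _ ⟩
  sum (map f (g x)) + sum (map f (concatMap g xs)) ≡⟨ cong (sum (map f (g x)) +_) (sum-map-concatMap f g xs) ⟩
  sum (map f (g x)) + sum (map (λ x → sum (map f (g x))) xs) ∎

sum-map-swap : ∀ (F : A → B → ℕ) xs ys →
               sum (map (λ x → sum (map (F x) ys)) xs) ≡ sum (map (λ y → sum (map (λ x → F x y) xs)) ys)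
sum-map-swap F []       ys = sym (sum-map-zero ys)
sum-map-swap F (x ∷ xs) ys = trans (cong (sum (map (F x) ys) +_) (sum-map-swap F xs ys))
                                   (sym (sum-map-+ (F x) (λ y → sum (map (λ x → F x y) xs)) ys))

map-allFin-suc : ∀ {n} (h : Fin (suc n) → A) → map h (allFin (suc n)) ≡ h fzero ∷ map (h ∘ fsuc) (allFin n)
map-allFin-suc {n = n} h = cong (h fzero ∷_) (trans (map-tabulate fsuc h) (sym (map-tabulate (λ i → i) (h ∘ fsuc))))

sum-allVecs-product : ∀ (xs : List A) n (w : Fin n → A → ℕ) →
  sum (map (λ q → product (map (λ v → w v (lookup q v)) (allFin n))) (allVecs xs n))
  ≡ product (map (λ v → sum (map (w v) xs)) (allFin n))
sum-allVecs-product xs zero    w = refl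
sum-allVecs-product {A} xs (suc n) w = begin
  sum (map term (concatMap (λ x → map (x ∷ᵛ_) (allVecs xs n)) xs))
    ≡⟨ sum-map-concatMap term (λ x → map (x ∷ᵛ_) (allVecs xs n)) xs ⟩
  sum (map (λ x → sum (map term (map (x ∷ᵛ_) (allVecs xs n)))) xs)
    ≡⟨ sum-map-cong xs row ⟩
  sum (map (λ x → w fzero x * rest) xs)
    ≡⟨ sum-map-*ʳ rest (w fzero) xs ⟩
  sum (map (w fzero) xs) * rest
    ≡⟨ cong product (map-allFin-suc (λ v → sum (map (w v) xs))) ⟨
  product (map (λ v → sum (map (w v) xs)) (allFin (suc n)))
    ∎
  where
  term : Vec A (suc n) → ℕ
  term q = product (map (λ v → w v (lookup q v)) (allFin (suc n)))
  term′ : Vec A n → ℕ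
  term′ q = product (map (λ v → w (fsuc v) (lookup q v)) (allFin n))
  rest : ℕ
  rest = product (map (λ v → sum (map (w (fsuc v)) xs)) (allFin n))
  row : ∀ x → sum (map term (map (x ∷ᵛ_) (allVecs xs n))) ≡ w fzero x * rest
  row x = begin
    sum (map term (map (x ∷ᵛ_) (allVecs xs n)))       ≡⟨ cong sum (map-∘ (allVecs xs n)) ⟨
    sum (map (term ∘ (x ∷ᵛ_)) (allVecs xs n))         ≡⟨ sum-map-cong (allVecs xs n) (λ q → cong product (map-allFin-suc (λ v → w v (lookup (x ∷ᵛ q) v)))) ⟩
    sum (map (λ q → w fzero x * term′ q) (allVecs xs n)) ≡⟨ sum-map-*ˡ (w fzero x) term′ (allVecs xs n) ⟩
    w fzero x * sum (map term′ (allVecs xs n))         ≡⟨ cong (w fzero x *_) (sum-allVecs-product xs n (w ∘ fsuc)) ⟩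
    w fzero x * rest                                      ∎

-- Counting forests with a given ascent vector

bitVectors : (r : ℕ) → List (Vec Bool r)
bitVectors = allVecs (true ∷ false ∷ [])

infix 4 _≟ᵛ_
_≟ᵛ_ : ∀ {r} (D E : Vec Bool r) → Dec (D ≡ E)
_≟ᵛ_ = ≡-dec _≟ᵇ_

sum-bitVectors-suc : ∀ {r} (h : Vec Bool (suc r) → ℕ) →
  sum (map h (bitVectors (suc r))) ≡ sum (map (h ∘ (true ∷ᵛ_)) (bitVectors r)) + sum (map (h ∘ (false ∷ᵛ_)) (bitVectors r))
sum-bitVectors-suc {r} h = trans (sum-map-concatMap h (λ b → map (b ∷ᵛ_) (bitVectors r)) (true ∷ false ∷ []))
  (cong₂ _+_ (cong sum (sym (map-∘ (bitVectors r)))) (trans (+-identityʳ _) (cong sum (sym (map-∘ (bitVectors r))))))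

sum-≟-bitVectors : ∀ {r} (E : Vec Bool r) → sum (map (λ D → 𝟙 (does (D ≟ᵛ E))) (bitVectors r)) ≡ 1
sum-≟-bitVectors []ᵛ = refl
sum-≟-bitVectors {suc r} (true ∷ᵛ E) = trans (sum-bitVectors-suc (λ D → 𝟙 (does (D ≟ᵛ true ∷ᵛ E))))
  (cong₂ _+_ (sum-≟-bitVectors E) (sum-map-zero (bitVectors r)))
sum-≟-bitVectors {suc r} (false ∷ᵛ E) = trans (sum-bitVectors-suc (λ D → 𝟙 (does (D ≟ᵛ false ∷ᵛ E))))
  (cong₂ _+_ (sum-map-zero (bitVectors r)) (sum-≟-bitVectors E))

module _ {n : ℕ} (p : Parent n) where

  compatible⇒≡ascents : ∀ {D} → T (compatible D p) → D ≡ ascents p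
  compatible⇒≡ascents {D} compat = trans (sym (tabulate∘lookup D)) (tabulate-cong (compatible⇒ascents {D = D} {p = p} compat))

  𝟙-compatible : ∀ D → 𝟙 (compatible D p) ≡ 𝟙 (compatible (ascents p) p) * 𝟙 (does (D ≟ᵛ ascents p))
  𝟙-compatible D with D ≟ᵛ ascents p
  ... | yes refl = sym (*-identityʳ _)
  ... | no D≢ with compatible D p in compat
  ...   | false = sym (*-zeroʳ (𝟙 (compatible (ascents p) p)))
  ...   | true  = ⊥-elim (D≢ (compatible⇒≡ascents (Equivalence.from T-≡ compat)))

  sum-compatible : sum (map (λ D → 𝟙 (compatible D p)) (bitVectors n)) ≡ 𝟙 (compatible (ascents p) p)
  sum-compatible = begin
    sum (map (λ D → 𝟙 (compatible D p)) (bitVectors n))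
      ≡⟨ sum-map-cong (bitVectors n) 𝟙-compatible ⟩
    sum (map (λ D → 𝟙 (compatible (ascents p) p) * 𝟙 (does (D ≟ᵛ ascents p))) (bitVectors n))
      ≡⟨ sum-map-*ˡ (𝟙 (compatible (ascents p) p)) _ (bitVectors n) ⟩
    𝟙 (compatible (ascents p) p) * sum (map (λ D → 𝟙 (does (D ≟ᵛ ascents p))) (bitVectors n))
      ≡⟨ cong (𝟙 (compatible (ascents p) p) *_) (sum-≟-bitVectors (ascents p)) ⟩
    𝟙 (compatible (ascents p) p) * 1
      ≡⟨ *-identityʳ _ ⟩
    𝟙 (compatible (ascents p) p) ∎

nonAscents : ∀ {r} → Vec Bool r → ℕ
nonAscents []ᵛ      = 0
nonAscents (b ∷ᵛ D) = 𝟙 (not b) + nonAscents D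

nonAscents≤ : ∀ {r} (D : Vec Bool r) → nonAscents D ≤ r
nonAscents≤ []ᵛ          = z≤n
nonAscents≤ (true ∷ᵛ D)  = m≤n⇒m≤1+n (nonAscents≤ D)
nonAscents≤ (false ∷ᵛ D) = s≤s (nonAscents≤ D)

sum-nonAscents : ∀ {r} (D : Vec Bool r) → sum (map (λ u → 𝟙 (not (lookup D u))) (allFin r)) ≡ nonAscents D
sum-nonAscents []ᵛ      = refl
sum-nonAscents (b ∷ᵛ D) = trans (cong sum (map-allFin-suc (λ u → 𝟙 (not (lookup (b ∷ᵛ D) u)))))
                                (cong (𝟙 (not b) +_) (sum-nonAscents D))

-- The number of allowed parents of v when c further candidates are open to non-ascents: the
-- root and the non-ascents preceding the vector.
parentCount : ∀ {r} → ℕ → Vec Bool r → Fin r → ℕ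
parentCount c D v = (if lookup D v then 0 else c) + sum (map (𝟙 ∘ edgeAllowed D v) (allFin _))

weight : ∀ {r} → ℕ → Vec Bool r → ℕ
weight c []ᵛ      = 1
weight c (b ∷ᵛ D) = (if b then nonAscents D else c) * weight (𝟙 (not b) + c) D

parentCount-zero : ∀ {r} c b (D : Vec Bool r) → parentCount c (b ∷ᵛ D) fzero ≡ (if b then nonAscents D else c)
parentCount-zero c true  D = trans (cong sum (map-allFin-suc (𝟙 ∘ edgeAllowed (true ∷ᵛ D) fzero))) (sum-nonAscents D)
parentCount-zero {r} c false D = begin
  c + sum (map (𝟙 ∘ edgeAllowed (false ∷ᵛ D) fzero) (allFin (suc r)))
    ≡⟨ cong (λ s → c + sum s) (map-allFin-suc (𝟙 ∘ edgeAllowed (false ∷ᵛ D) fzero)) ⟩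
  c + sum (map (λ _ → 0) (allFin r))
    ≡⟨ cong (c +_) (sum-map-zero (allFin r)) ⟩
  c + 0
    ≡⟨ +-identityʳ c ⟩
  c ∎

parentCount-suc : ∀ {r} c b (D : Vec Bool r) v → parentCount c (b ∷ᵛ D) (fsuc v) ≡ parentCount (𝟙 (not b) + c) D v
parentCount-suc {r} c b D v = begin
  (if lookup D v then 0 else c) + sum (map (𝟙 ∘ edgeAllowed (b ∷ᵛ D) (fsuc v)) (allFin (suc r)))
    ≡⟨ cong (λ s → (if lookup D v then 0 else c) + sum s) (map-allFin-suc (𝟙 ∘ edgeAllowed (b ∷ᵛ D) (fsuc v))) ⟩
  (if lookup D v then 0 else c) + (𝟙 ((if lookup D v then false else true) ∧ not b) + rest)
    ≡⟨ shift (lookup D v) ⟩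
  (if lookup D v then 0 else 𝟙 (not b) + c) + rest ∎
  where
  rest : ℕ
  rest = sum (map (𝟙 ∘ edgeAllowed D v) (allFin r))
  shift : ∀ d → (if d then 0 else c) + (𝟙 ((if d then false else true) ∧ not b) + rest)
              ≡ (if d then 0 else 𝟙 (not b) + c) + rest
  shift true  = refl
  shift false = x∙yz≈yx∙z c (𝟙 (not b)) rest

product-parentCount : ∀ {r} c (D : Vec Bool r) → product (map (parentCount c D) (allFin r)) ≡ weight c D
product-parentCount c []ᵛ      = refl
product-parentCount {suc r} c (b ∷ᵛ D) = begin
  product (map (parentCount c (b ∷ᵛ D)) (allFin (suc r)))
    ≡⟨ cong product (map-allFin-suc (parentCount c (b ∷ᵛ D))) ⟩
  parentCount c (b ∷ᵛ D) fzero * product (map (parentCount c (b ∷ᵛ D) ∘ fsuc) (allFin r))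
    ≡⟨ cong₂ _*_ (parentCount-zero c b D) (cong product (map-cong (parentCount-suc c b D) (allFin r))) ⟩
  (if b then nonAscents D else c) * product (map (parentCount (𝟙 (not b) + c) D) (allFin r))
    ≡⟨ cong ((if b then nonAscents D else c) *_) (product-parentCount (𝟙 (not b) + c) D) ⟩
  weight c (b ∷ᵛ D) ∎

𝟙-not : ∀ b → 𝟙 (not b) ≡ (if b then 0 else 1)
𝟙-not true  = refl
𝟙-not false = refl

sum-parentAllowed : ∀ {n} (D : Vec Bool n) v →
                    sum (map (𝟙 ∘ parentAllowed D v) (nothing ∷ map just (allFin n))) ≡ parentCount 1 D v
sum-parentAllowed {n} D v = cong₂ _+_ (𝟙-not (lookup D v)) (cong sum (sym (map-∘ (allFin n))))

count-compatible : ∀ {n} (D : Vec Bool n) → sum (map (λ p → 𝟙 (compatible D p)) (allParents n)) ≡ weight 1 D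
count-compatible {n} D = begin
  sum (map (λ p → 𝟙 (compatible D p)) (allParents n))
    ≡⟨ sum-map-cong (allParents n) (λ p → 𝟙-all (λ v → parentAllowed D v (lookup p v)) (allFin n)) ⟩
  sum (map (λ p → product (map (λ v → 𝟙 (parentAllowed D v (lookup p v))) (allFin n))) (allParents n))
    ≡⟨ sum-allVecs-product (nothing ∷ map just (allFin n)) n (λ v → 𝟙 ∘ parentAllowed D v) ⟩
  product (map (λ v → sum (map (𝟙 ∘ parentAllowed D v) (nothing ∷ map just (allFin n)))) (allFin n))
    ≡⟨ cong product (map-cong (sum-parentAllowed D) (allFin n)) ⟩
  product (map (parentCount 1 D) (allFin n))
    ≡⟨ product-parentCount 1 D ⟩
  weight 1 D ∎

count-forests : ∀ n → f n headDescentPatterns ≡ sum (map (weight 1) (bitVectors n))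
count-forests n = begin
  length (filterᵇ forestAvoiding (allParents n))
    ≡⟨ length-filterᵇ forestAvoiding (allParents n) ⟩
  sum (map (𝟙 ∘ forestAvoiding) (allParents n))
    ≡⟨ sum-map-cong (allParents n) (λ p → cong 𝟙 (forest-avoiding≡compatible p)) ⟩
  sum (map (λ p → 𝟙 (compatible (ascents p) p)) (allParents n))
    ≡⟨ sum-map-cong (allParents n) sum-compatible ⟨
  sum (map (λ p → sum (map (λ D → 𝟙 (compatible D p)) (bitVectors n))) (allParents n))
    ≡⟨ sum-map-swap (λ p D → 𝟙 (compatible D p)) (allParents n) (bitVectors n) ⟩
  sum (map (λ D → sum (map (λ p → 𝟙 (compatible D p)) (allParents n))) (bitVectors n))
    ≡⟨ sum-map-cong (bitVectors n) count-compatible ⟩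
  sum (map (weight 1) (bitVectors n)) ∎
  where
  forestAvoiding : Parent n → Bool
  forestAvoiding p = isForest p ∧ avoidsAll p headDescentPatterns

-- Stirling numbers

rising : ℕ → ℕ → ℕ
rising c zero    = 1
rising c (suc m) = c * rising (suc c) m

rising-suc-! : ∀ c m → rising (suc c) m * c ! ≡ (c + m) !
rising-suc-! c zero    = trans (+-identityʳ (c !)) (cong _! (sym (+-identityʳ c)))
rising-suc-! c (suc m) = begin
  suc c * rising (suc (suc c)) m * c !   ≡⟨ xy∙z≈y∙xz (suc c) (rising (suc (suc c)) m) (c !) ⟩
  rising (suc (suc c)) m * suc c !       ≡⟨ rising-suc-! (suc c) m ⟩
  (suc c + m) !                          ≡⟨ cong _! (sym (+-suc c m)) ⟩
  (c + suc m) !                          ∎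

rising-1 : ∀ m → rising 1 m ≡ m !
rising-1 m = trans (sym (*-identityʳ (rising 1 m))) (rising-suc-! 0 m)

𝟙-≡ᵇ-* : ∀ k m w → 𝟙 (k ≡ᵇ m) * (k * w) ≡ m * (𝟙 (k ≡ᵇ m) * w)
𝟙-≡ᵇ-* k m w with k ≡ᵇ m in k≡ᵇm
... | false = sym (*-zeroʳ m)
... | true with ≡ᵇ⇒≡ k m (Equivalence.from T-≡ k≡ᵇm)
...   | refl = x∙yz≈y∙xz 1 k w

sum-weight-by-nonAscents : ∀ r c m →
  sum (map (λ D → 𝟙 (nonAscents D ≡ᵇ m) * weight c D) (bitVectors r)) ≡ rising c m * S r m
sum-weight-by-nonAscents zero    c zero    = refl
sum-weight-by-nonAscents zero    c (suc m) = sym (*-zeroʳ (rising c (suc m)))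
sum-weight-by-nonAscents (suc r) c m = begin
  sum (map (λ D → 𝟙 (nonAscents D ≡ᵇ m) * weight c D) (bitVectors (suc r)))
    ≡⟨ sum-bitVectors-suc {r} (λ D → 𝟙 (nonAscents D ≡ᵇ m) * weight c D) ⟩
  sum (map (λ D → 𝟙 (nonAscents D ≡ᵇ m) * (nonAscents D * weight c D)) (bitVectors r))
    + non-ascent-lowest m
    ≡⟨ cong (_+ non-ascent-lowest m) ascent-lowest ⟩
  m * (rising c m * S r m) + non-ascent-lowest m
    ≡⟨ stirling-recurrence m ⟩
  rising c m * S (suc r) m ∎
  where
  ascent-lowest : sum (map (λ D → 𝟙 (nonAscents D ≡ᵇ m) * (nonAscents D * weight c D)) (bitVectors r))
                 ≡ m * (rising c m * S r m)
  ascent-lowest = begin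
    sum (map (λ D → 𝟙 (nonAscents D ≡ᵇ m) * (nonAscents D * weight c D)) (bitVectors r))
      ≡⟨ sum-map-cong (bitVectors r) (λ D → 𝟙-≡ᵇ-* (nonAscents D) m (weight c D)) ⟩
    sum (map (λ D → m * (𝟙 (nonAscents D ≡ᵇ m) * weight c D)) (bitVectors r))
      ≡⟨ sum-map-*ˡ m (λ D → 𝟙 (nonAscents D ≡ᵇ m) * weight c D) (bitVectors r) ⟩
    m * sum (map (λ D → 𝟙 (nonAscents D ≡ᵇ m) * weight c D) (bitVectors r))
      ≡⟨ cong (m *_) (sum-weight-by-nonAscents r c m) ⟩
    m * (rising c m * S r m) ∎
  non-ascent-lowest : ℕ → ℕ
  non-ascent-lowest m = sum (map (λ D → 𝟙 (suc (nonAscents D) ≡ᵇ m) * (c * weight (suc c) D)) (bitVectors r))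
  stirling-recurrence : ∀ m → m * (rising c m * S r m) + non-ascent-lowest m ≡ rising c m * S (suc r) m
  stirling-recurrence zero = sum-map-zero (bitVectors r)
  stirling-recurrence (suc m) = begin
    suc m * (rising c (suc m) * S r (suc m))
      + sum (map (λ D → 𝟙 (nonAscents D ≡ᵇ m) * (c * weight (suc c) D)) (bitVectors r))
      ≡⟨ cong (suc m * (rising c (suc m) * S r (suc m)) +_) (begin
          sum (map (λ D → 𝟙 (nonAscents D ≡ᵇ m) * (c * weight (suc c) D)) (bitVectors r))
            ≡⟨ sum-map-cong (bitVectors r) (λ D → x∙yz≈y∙xz (𝟙 (nonAscents D ≡ᵇ m)) c (weight (suc c) D)) ⟩
          sum (map (λ D → c * (𝟙 (nonAscents D ≡ᵇ m) * weight (suc c) D)) (bitVectors r))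
            ≡⟨ sum-map-*ˡ c (λ D → 𝟙 (nonAscents D ≡ᵇ m) * weight (suc c) D) (bitVectors r) ⟩
          c * sum (map (λ D → 𝟙 (nonAscents D ≡ᵇ m) * weight (suc c) D) (bitVectors r))
            ≡⟨ cong (c *_) (sum-weight-by-nonAscents r (suc c) m) ⟩
          c * (rising (suc c) m * S r m) ∎) ⟩
    suc m * (c * rising (suc c) m * S r (suc m)) + c * (rising (suc c) m * S r m)
      ≡⟨ stirling-step (suc m) c (rising (suc c) m) (S r (suc m)) (S r m) ⟩
    c * rising (suc c) m * (suc m * S r (suc m) + S r m) ∎
    where
    stirling-step : ∀ k c R A B → k * (c * R * A) + c * (R * B) ≡ c * R * (k * A + B)
    stirling-step = solve-∀

sum-map-upTo-suc : ∀ (h : ℕ → ℕ) n → sum (map h (upTo (suc n))) ≡ h 0 + sum (map (h ∘ suc) (upTo n))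
sum-map-upTo-suc h n =
  cong (λ xs → h 0 + sum xs) (trans (map-applyUpTo suc h n) (sym (map-applyUpTo (λ m → m) (h ∘ suc) n)))

sum-≡ᵇ-upTo : ∀ {k} n → k < n → sum (map (λ m → 𝟙 (k ≡ᵇ m)) (upTo n)) ≡ 1
sum-≡ᵇ-upTo {zero}  (suc n) _ =
  trans (sum-map-upTo-suc (λ m → 𝟙 (0 ≡ᵇ m)) n) (cong suc (sum-map-zero (upTo n)))
sum-≡ᵇ-upTo {suc k} (suc n) (s≤s k<n) =
  trans (sum-map-upTo-suc (λ m → 𝟙 (suc k ≡ᵇ m)) n) (sum-≡ᵇ-upTo n k<n)

weight-by-nonAscents : ∀ {n} (D : Vec Bool n) →
  weight 1 D ≡ sum (map (λ m → 𝟙 (nonAscents D ≡ᵇ m) * weight 1 D) (upTo (suc n)))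
weight-by-nonAscents {n} D = sym (begin
  sum (map (λ m → 𝟙 (nonAscents D ≡ᵇ m) * weight 1 D) (upTo (suc n)))
    ≡⟨ sum-map-*ʳ (weight 1 D) (λ m → 𝟙 (nonAscents D ≡ᵇ m)) (upTo (suc n)) ⟩
  sum (map (λ m → 𝟙 (nonAscents D ≡ᵇ m)) (upTo (suc n))) * weight 1 D
    ≡⟨ cong (_* weight 1 D) (sum-≡ᵇ-upTo (suc n) (s≤s (nonAscents≤ D))) ⟩
  1 * weight 1 D
    ≡⟨ *-identityˡ (weight 1 D) ⟩
  weight 1 D ∎)

sum-weight : ∀ n → sum (map (weight 1) (bitVectors n)) ≡ sum (map (λ m → m ! * S n m) (upTo (suc n)))
sum-weight n = begin
  sum (map (weight 1) (bitVectors n))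
    ≡⟨ sum-map-cong (bitVectors n) weight-by-nonAscents ⟩
  sum (map (λ D → sum (map (λ m → 𝟙 (nonAscents D ≡ᵇ m) * weight 1 D) (upTo (suc n)))) (bitVectors n))
    ≡⟨ sum-map-swap (λ D m → 𝟙 (nonAscents D ≡ᵇ m) * weight 1 D) (bitVectors n) (upTo (suc n)) ⟩
  sum (map (λ m → sum (map (λ D → 𝟙 (nonAscents D ≡ᵇ m) * weight 1 D) (bitVectors n))) (upTo (suc n)))
    ≡⟨ sum-map-cong (upTo (suc n)) (λ m → trans (sum-weight-by-nonAscents n 1 m) (cong (_* S n m) (rising-1 m))) ⟩
  sum (map (λ m → m ! * S n m) (upTo (suc n))) ∎

-- The m = 0 summand vanishes because S (suc n) 0 = 0; this is where 1 ≤ n is needed.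
theorem5p3 : (n : ℕ) → 1 ≤ n → f n ((3 ∷ 1 ∷ 2 ∷ []) ∷ (2 ∷ 1 ∷ 3 ∷ []) ∷ (3 ∷ 2 ∷ 1 ∷ []) ∷ []) ≡ fubini n
theorem5p3 (suc n) _ = begin
  f (suc n) headDescentPatterns                             ≡⟨ count-forests (suc n) ⟩
  sum (map (weight 1) (bitVectors (suc n)))                  ≡⟨ sum-weight (suc n) ⟩
  sum (map (λ m → m ! * S (suc n) m) (upTo (suc (suc n))))   ≡⟨ sum-map-upTo-suc (λ m → m ! * S (suc n) m) (suc n) ⟩
  fubini (suc n)                                            ∎
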